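{- Let $M$ be a positive integer and consider an $M$-degree-bounded locality-aware healing algorithm used on a tree. Then the deletion of a node $v$ of degree at least $M+3$ leads to a degree increase for at least two neighbours of $v$.
   Context: The network is a tree. An adversary deletes nodes one at a time. After the deletion of $x$, the healing algorithm keeps the network connected by adding edges only between former neighbours of $x$ (locality-aware). A healing algorithm is $M$-degree-bounded if any node can increase its degree by at most $M$ in a single round of deletion and healing. -}

module Defs where

open import Data.Nat using (ℕ; zero; suc; _+_; _≤_; _<_)
open import Data.Bool using (Bool; true; false; T; if_then_else_)
open import Data.Fin using (Fin)
open import Data.List using (List; []; _∷_; _++_; map; allFin)
open import Data.Nat.ListAction using (sum)
open import Data.Empty using (⊥)
open import Data.List.Relation.Unary.Unique.Propositional using (Unique)
open import Data.Product using (Σ; _×_; ∃; ∃-syntax)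
open import Data.Unit using (⊤)
open import Relation.Binary.PropositionalEquality using (_≡_; _≢_)

Graph : ℕ → Set
Graph n = Fin n → Fin n → Bool

module _ {n : ℕ} (G : Graph n) where

  Adj : Fin n → Fin n → Set
  Adj u w = T (G u w)

  IsSimple : Set
  IsSimple = (∀ u w → G u w ≡ G w u) × (∀ u → G u u ≡ false)

  deg : Fin n → ℕ
  deg u = sum (map (λ w → if G u w then 1 else 0) (allFin n))

  AdjChain : List (Fin n) → Set
  AdjChain [] = ⊤
  AdjChain (a ∷ []) = ⊤
  AdjChain (a ∷ b ∷ rest) = Adj a b × AdjChain (b ∷ rest)

  data Walk : Fin n → Fin n → Set where
    here : ∀ {u} → Walk u u
    step : ∀ {u v w} → Adj u v → Walk v w → Walk u w

  Connected : Set
  Connected = ∀ u w → Walk u w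

  -- a cycle a, mid..., z, a  with at least 3 distinct vertices
  HasCycle : Set
  HasCycle = Σ (Fin n) λ a → Σ (List (Fin n)) λ mid → Σ (Fin n) λ z →
    (mid ≢ []) × Unique (a ∷ mid ++ z ∷ []) × AdjChain (a ∷ mid ++ z ∷ []) × Adj z a

  Acyclic : Set
  Acyclic = HasCycle → ⊥

  IsTree : Set
  IsTree = IsSimple × Connected × Acyclic

-- G is the network before the deletion of x, H is the network after deletion
-- of x and healing (on the same vertex set; x is isolated in H and is
-- regarded as removed).
record LocalHealing {n : ℕ} (G H : Graph n) (x : Fin n) : Set where
  field
    simpleH    : IsSimple H
    removed    : ∀ u → H x u ≡ false
    keepEdges  : ∀ u w → u ≢ x → w ≢ x → Adj G u w → Adj H u w
    localNew   : ∀ u w → Adj H u w → G u w ≡ false → Adj G x u × Adj G x w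
    connected  : ∀ u w → u ≢ x → w ≢ x → Walk H u w

DegreeBounded : ∀ {n} → ℕ → Graph n → Graph n → Fin n → Set
DegreeBounded M G H x = ∀ u → u ≢ x → deg H u ≤ deg G u + M

module Submission where

-- Let N be the graph of new edges. A surviving node u keeps every old edge except the one
-- to v, so deg G u + deg N u ≤ deg H u + 1: a neighbour of v whose degree does not grow
-- gains at most one new edge, and every neighbour gains at most M + 1. As G is a tree,
-- distinct neighbours of v lie in distinct components of G ∖ v, so in H these components
-- can only be linked by new edges. If at most one neighbour c of v grows, every other
-- neighbour w must get a new edge to c: otherwise w with its new partners would be cut
-- off from c in H. Hence deg G v ≤ deg N c + 1 ≤ M + 2.

open import Defs
open import Data.Nat using (ℕ; zero; suc; _+_; _≤_; _<_; z≤n; s≤s; _<?_)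
open import Data.Nat.Properties
  using (+-mono-≤; ≤-refl; ≤-trans; m≤m+n; m≤n+m; +-assoc; +-comm; +-identityʳ; +-cancelˡ-≤; ≮⇒≥;
         +-commutativeSemigroup; module ≤-Reasoning)
open import Algebra.Properties.CommutativeSemigroup +-commutativeSemigroup
  using (interchange; xy∙z≈xz∙y)
open import Data.Nat.ListAction using (sum)
open import Data.Fin using (Fin; zero; suc; _≟_)
open import Data.Fin.Properties using (any?; suc-injective)
open import Data.Bool using (Bool; true; false; T; if_then_else_; _∧_; not)
open import Data.Bool.Properties using (T-∧; T-not-≡)
open import Data.List using (List; []; _∷_; _++_; tabulate; last)
open import Data.List.Properties using (map-tabulate; ∷-injectiveˡ)
open import Data.List.Relation.Unary.Any using (here; there)
open import Data.List.Relation.Unary.All as All using (All; []; _∷_)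
open import Data.List.Relation.Unary.All.Properties.Core using (¬Any⇒All¬)
open import Data.List.Relation.Unary.Unique.Propositional using (Unique)
open import Data.List.Relation.Unary.AllPairs using ([]; _∷_)
open import Data.Maybe using (just)
open import Data.Maybe.Properties using (just-injective)
open import Data.Product using (Σ; _×_; _,_; proj₁; proj₂; ∃)
open import Data.Sum using (_⊎_; inj₁; inj₂)
open import Data.Empty using (⊥; ⊥-elim)
open import Data.Unit using (tt)
open import Function using (_∘_; id; Equivalence)
open import Relation.Nullary using (¬_; yes; no)
open import Relation.Nullary.Decidable using (T?; ¬?; _×-dec_; isNo; fromWitnessFalse; toWitnessFalse)
open import Relation.Unary using (Pred)
open import Relation.Binary.PropositionalEquality
  using (_≡_; _≢_; refl; sym; trans; cong; cong₂; subst; module ≡-Reasoning)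

∑ : ∀ {n} → (Fin n → ℕ) → ℕ
∑ f = sum (tabulate f)

∑-mono-≤ : ∀ {n} {f g : Fin n → ℕ} → (∀ i → f i ≤ g i) → ∑ f ≤ ∑ g
∑-mono-≤ {zero}  _   = z≤n
∑-mono-≤ {suc n} f≤g = +-mono-≤ (f≤g zero) (∑-mono-≤ (f≤g ∘ suc))

∑-distrib-+ : ∀ {n} (f g : Fin n → ℕ) → ∑ (λ i → f i + g i) ≡ ∑ f + ∑ g
∑-distrib-+ {zero}  f g = refl
∑-distrib-+ {suc n} f g = begin
  (f zero + g zero) + ∑ (λ i → f (suc i) + g (suc i))
    ≡⟨ cong (f zero + g zero +_) (∑-distrib-+ (f ∘ suc) (g ∘ suc)) ⟩
  (f zero + g zero) + (∑ (f ∘ suc) + ∑ (g ∘ suc))     ≡⟨ interchange (f zero) (g zero) _ _ ⟩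
  ∑ f + ∑ g                                           ∎
  where open ≡-Reasoning

∑-≤-except : ∀ {n} {f g : Fin n → ℕ} {k} (a : Fin n) →
             (∀ i → i ≢ a → f i ≤ g i) → f a ≤ g a + k → ∑ f ≤ ∑ g + k
∑-≤-except {suc n} {f} {g} {k} zero f≤g fa≤ = begin
  f zero + ∑ (f ∘ suc)     ≤⟨ +-mono-≤ fa≤ (∑-mono-≤ (λ i → f≤g (suc i) λ ())) ⟩
  g zero + k + ∑ (g ∘ suc) ≡⟨ xy∙z≈xz∙y (g zero) k _ ⟩
  ∑ g + k                  ∎
  where open ≤-Reasoning
∑-≤-except {suc n} {f} {g} {k} (suc a) f≤g fa≤ = begin
  f zero + ∑ (f ∘ suc)       ≤⟨ +-mono-≤ (f≤g zero λ ())
                                (∑-≤-except a (λ i i≢a → f≤g (suc i) (i≢a ∘ suc-injective)) fa≤) ⟩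
  g zero + (∑ (g ∘ suc) + k) ≡⟨ +-assoc (g zero) _ k ⟨
  ∑ g + k                    ∎
  where open ≤-Reasoning

∑-≥-point : ∀ {n} (f : Fin n → ℕ) (a : Fin n) → f a ≤ ∑ f
∑-≥-point f zero    = m≤m+n (f zero) _
∑-≥-point f (suc a) = ≤-trans (∑-≥-point (f ∘ suc) a) (m≤n+m _ (f zero))

∑-≥-pair : ∀ {n} (f : Fin n → ℕ) {a b : Fin n} → a ≢ b → f a + f b ≤ ∑ f
∑-≥-pair f {zero}  {zero}  a≢b = ⊥-elim (a≢b refl)
∑-≥-pair f {zero}  {suc b} _   = +-mono-≤ ≤-refl (∑-≥-point (f ∘ suc) b)
∑-≥-pair f {suc a} {zero}  _   =
  subst (_≤ ∑ f) (+-comm (f zero) (f (suc a))) (+-mono-≤ ≤-refl (∑-≥-point (f ∘ suc) a))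
∑-≥-pair f {suc a} {suc b} a≢b = ≤-trans (∑-≥-pair (f ∘ suc) (a≢b ∘ cong suc)) (m≤n+m _ (f zero))

∑-positive : ∀ {n} (f : Fin n → ℕ) → 0 < ∑ f → ∃ λ i → 0 < f i
∑-positive {suc n} f pos with f zero in eq
... | suc _ = zero , subst (0 <_) (sym eq) (s≤s z≤n)
... | zero  = let i , p = ∑-positive (f ∘ suc) pos in suc i , p

count : Bool → ℕ
count b = if b then 1 else 0

count-mono : ∀ {x y} → (T x → T y) → count x ≤ count y
count-mono {false}         _   = z≤n
count-mono {true}  {true}  _   = ≤-refl
count-mono {true}  {false} x⇒y = ⊥-elim (x⇒y tt)

count-≤-1 : ∀ b → count b ≤ 1
count-≤-1 false = z≤n
count-≤-1 true  = ≤-refl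

count-T : ∀ {b} → T b → count b ≡ 1
count-T {true} _ = refl

count-positive : ∀ {b} → 0 < count b → T b
count-positive {true} _ = tt

count-+-∧-not : ∀ x y → (T x → T y) → count x + count (y ∧ not x) ≤ count y
count-+-∧-not false false _   = ≤-refl
count-+-∧-not false true  _   = ≤-refl
count-+-∧-not true  true  _   = ≤-refl
count-+-∧-not true  false x⇒y = ⊥-elim (x⇒y tt)

count-+-∧-not-≤ : ∀ x y → count x + count (y ∧ not x) ≤ count y + 1
count-+-∧-not-≤ false false = z≤n
count-+-∧-not-≤ false true  = m≤m+n 1 1
count-+-∧-not-≤ true  false = ≤-refl
count-+-∧-not-≤ true  true  = m≤n+m 1 1

deg≡∑ : ∀ {n} (K : Graph n) u → deg K u ≡ ∑ (λ w → count (K u w))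
deg≡∑ K u = cong sum (map-tabulate id (λ w → count (K u w)))

module _ {n : ℕ} (K : Graph n) where

  deg-≥-2 : ∀ {u a b} → a ≢ b → Adj K u a → Adj K u b → 2 ≤ deg K u
  deg-≥-2 {u} {a} {b} a≢b ua ub = begin
    2                             ≡⟨ cong₂ _+_ (count-T ua) (count-T ub) ⟨
    count (K u a) + count (K u b) ≤⟨ ∑-≥-pair _ a≢b ⟩
    ∑ (λ w → count (K u w))       ≡⟨ deg≡∑ K u ⟨
    deg K u                       ∎
    where open ≤-Reasoning

  neighbour-unique : ∀ {u a b} → deg K u ≤ 1 → Adj K u a → Adj K u b → a ≡ b
  neighbour-unique {a = a} {b} deg≤1 ua ub with a ≟ b
  ... | yes a≡b = a≡b
  ... | no  a≢b with ≤-trans (deg-≥-2 a≢b ua ub) deg≤1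
  ...   | s≤s ()

  deg-positive⇒neighbour : ∀ {u} → 0 < deg K u → ∃ (Adj K u)
  deg-positive⇒neighbour {u} pos =
    let w , p = ∑-positive _ (subst (0 <_) (deg≡∑ K u) pos) in w , count-positive p

  deg-≤-except : ∀ {K′ u u′} (a : Fin n) → (∀ w → w ≢ a → Adj K u w → Adj K′ u′ w) →
                 deg K u ≤ deg K′ u′ + 1
  deg-≤-except {K′} {u} {u′} a sub = begin
    deg K u                          ≡⟨ deg≡∑ K u ⟩
    ∑ (λ w → count (K u w))          ≤⟨ ∑-≤-except a (λ w w≢a → count-mono (sub w w≢a))
                                                     (≤-trans (count-≤-1 _) (m≤n+m 1 _)) ⟩
    ∑ (λ w → count (K′ u′ w)) + 1    ≡⟨ cong (_+ 1) (deg≡∑ K′ u′) ⟨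
    deg K′ u′ + 1                    ∎
    where open ≤-Reasoning

module _ {n : ℕ} {K : Graph n} (simple : IsSimple K) where

  Adj-sym : ∀ {a b} → Adj K a b → Adj K b a
  Adj-sym {a} {b} = subst T (proj₁ simple a b)

  Adj⇒≢ : ∀ {a b} → Adj K a b → a ≢ b
  Adj⇒≢ {a} aa refl = subst T (proj₂ simple a) aa

_∖_ : ∀ {n} → Graph n → Fin n → Graph n
(K ∖ v) a b = K a b ∧ isNo (a ≟ v) ∧ isNo (b ≟ v)

module _ {n : ℕ} {K : Graph n} {v : Fin n} where

  ∖-intro : ∀ {a b} → Adj K a b → a ≢ v → b ≢ v → Adj (K ∖ v) a b
  ∖-intro {a} {b} ab a≢v b≢v = Equivalence.from (T-∧ {K a b})
    (ab , Equivalence.from (T-∧ {isNo (a ≟ v)})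
            (fromWitnessFalse {a? = a ≟ v} a≢v , fromWitnessFalse {a? = b ≟ v} b≢v))

  ∖-elim : ∀ {a b} → Adj (K ∖ v) a b → Adj K a b × b ≢ v
  ∖-elim {a} {b} ab = let ab′ , rest = Equivalence.to (T-∧ {K a b}) ab in
    ab′ , toWitnessFalse {a? = b ≟ v} (proj₂ (Equivalence.to (T-∧ {isNo (a ≟ v)}) rest))

  AdjChain-∖ : ∀ a ys → AdjChain (K ∖ v) (a ∷ ys) → AdjChain K (a ∷ ys) × All (_≢ v) ys
  AdjChain-∖ a []       _        = tt , []
  AdjChain-∖ a (b ∷ ys) (ab , c) =
    let ab′ , b≢v = ∖-elim ab ; c′ , avoids = AdjChain-∖ b ys c in (ab′ , c′) , b≢v ∷ avoids

record Path {n} (K : Graph n) (a b : Fin n) : Set where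
  constructor path
  field
    rest   : List (Fin n)
    unique : Unique (a ∷ rest)
    chain  : AdjChain K (a ∷ rest)
    ends   : last (a ∷ rest) ≡ just b

module _ {n : ℕ} {K : Graph n} where
  open import Data.List.Membership.DecPropositional (_≟_ {n}) using (_∈_; _∈?_)

  suffix-path : ∀ {a b xs} → a ∈ xs → Unique xs → AdjChain K xs → last xs ≡ just b → Path K a b
  suffix-path {xs = x ∷ ys}     (here refl) u       c       l = path ys u c l
  suffix-path {xs = x ∷ y ∷ ys} (there a∈)  (_ ∷ u) (_ , c) l = suffix-path a∈ u c l

  loop-erase : ∀ {a b} → Walk K a b → Path K a b
  loop-erase here = path [] ([] ∷ []) tt refl
  loop-erase {a} (step {v = x} ax w) with loop-erase w
  ... | path ys u c l with a ∈? x ∷ ys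
  ...   | yes a∈ = suffix-path a∈ u c l
  ...   | no  a∉ = path (x ∷ ys) (¬Any⇒All¬ _ a∉ ∷ u) (ax , c) l

last-split : ∀ {A : Set} {b : A} xs → last xs ≡ just b → ∃ λ mid → xs ≡ mid ++ b ∷ []
last-split (x ∷ [])     eq = [] , cong (_∷ []) (just-injective eq)
last-split (x ∷ y ∷ ys) eq = let mid , p = last-split (y ∷ ys) eq in x ∷ mid , cong (x ∷_) p

-- Loop-erasing the walk and closing it up through v yields a cycle.
neighbours-separated : ∀ {n} {G : Graph n} {v a b} → IsSimple G → Acyclic G →
                       Adj G v a → Adj G v b → Walk (G ∖ v) a b → a ≡ b
neighbours-separated {G = G} {v} {a} {b} simple acyclic va vb w with a ≟ b | loop-erase w
... | yes a≡b | _ = a≡b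
... | no  a≢b | path rest unique chain ends with last-split (a ∷ rest) ends
...   | mid , split =
  ⊥-elim (acyclic (v , mid , b , mid≢[] , cycle-unique , cycle-chain , Adj-sym simple vb))
  where
  v∉ : All (v ≢_) (a ∷ rest)
  v∉ = Adj⇒≢ simple va ∷ All.map (_∘ sym) (proj₂ (AdjChain-∖ {K = G} a rest chain))
  cycle-unique : Unique (v ∷ mid ++ b ∷ [])
  cycle-unique = subst (λ L → Unique (v ∷ L)) split (v∉ ∷ unique)
  cycle-chain : AdjChain G (v ∷ mid ++ b ∷ [])
  cycle-chain =
    subst (λ L → AdjChain G (v ∷ L)) split (va , proj₁ (AdjChain-∖ {K = G} a rest chain))
  mid≢[] : mid ≢ []
  mid≢[] refl = a≢b (∷-injectiveˡ split)

newEdges : ∀ {n} → Graph n → Graph n → Graph n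
newEdges G H a b = H a b ∧ not (G a b)

module Healing {n : ℕ} {G H : Graph n} {v : Fin n}
               (simple : IsSimple G) (acyclic : Acyclic G) (healing : LocalHealing G H v) where
  open LocalHealing healing

  N : Graph n
  N = newEdges G H

  new-intro : ∀ {a b} → Adj H a b → G a b ≡ false → Adj N a b
  new-intro {a} {b} ab ¬ab = Equivalence.from (T-∧ {H a b}) (ab , Equivalence.from T-not-≡ ¬ab)

  new-elim : ∀ {a b} → Adj N a b → Adj H a b × G a b ≡ false
  new-elim {a} {b} ab = let h , g = Equivalence.to (T-∧ {H a b}) ab in h , Equivalence.to T-not-≡ g

  new-sym : ∀ {a b} → Adj N a b → Adj N b a
  new-sym {a} {b} ab = let h , g = new-elim ab in
    new-intro (Adj-sym simpleH h) (trans (proj₁ simple b a) g)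

  new⇒neighbours : ∀ {a b} → Adj N a b → Adj G v a × Adj G v b
  new⇒neighbours ab = let h , g = new-elim ab in localNew _ _ h g

  healed-avoids : ∀ {a b} → Adj H a b → a ≢ v × b ≢ v
  healed-avoids {a} {b} ab =
    (λ { refl → subst T (removed b) ab }) , (λ { refl → subst T (removed a) (Adj-sym simpleH ab) })

  neighbour≢v : ∀ {a} → Adj G v a → a ≢ v
  neighbour≢v va = Adj⇒≢ simple va ∘ sym

  lost-edge-bound : ∀ {u} → u ≢ v → deg G u + deg N u ≤ deg H u + 1
  lost-edge-bound {u} u≢v = begin
    deg G u + deg N u                                  ≡⟨ cong₂ _+_ (deg≡∑ G u) (deg≡∑ N u) ⟩
    ∑ (λ w → count (G u w)) + ∑ (λ w → count (N u w))
      ≡⟨ ∑-distrib-+ (λ w → count (G u w)) (λ w → count (N u w)) ⟨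
    ∑ (λ w → count (G u w) + count (N u w))            ≤⟨ ∑-≤-except v
                                                            (λ w w≢v → count-+-∧-not _ _ (keepEdges u w u≢v w≢v))
                                                            (count-+-∧-not-≤ _ _) ⟩
    ∑ (λ w → count (H u w)) + 1                        ≡⟨ cong (_+ 1) (deg≡∑ H u) ⟨
    deg H u + 1                                        ∎
    where open ≤-Reasoning

  new-deg-bound : ∀ {u k} → u ≢ v → deg H u ≤ deg G u + k → deg N u ≤ k + 1
  new-deg-bound {u} {k} u≢v grown = +-cancelˡ-≤ (deg G u) _ _ (begin
    deg G u + deg N u ≤⟨ lost-edge-bound u≢v ⟩
    deg H u + 1       ≤⟨ +-mono-≤ grown ≤-refl ⟩
    deg G u + k + 1   ≡⟨ +-assoc (deg G u) k 1 ⟩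
    deg G u + (k + 1) ∎)
    where open ≤-Reasoning

  module _ {ℓ} (S : Pred (Fin n) ℓ) (S⊆neighbours : ∀ {t} → S t → Adj G v t)
           (closed : ∀ {y z} → S y → Adj N y z → S z) where

    -- Invariant of H-walks from S: old edges keep y in its component of G ∖ v, and a new
    -- edge starts at a neighbour of v, which must be t itself; closure puts its end in S.
    Reaches : Fin n → Set ℓ
    Reaches y = ∃ λ t → S t × Walk (G ∖ v) y t

    reaches-step : ∀ {y z} → Reaches y → Adj H y z → Reaches z
    reaches-step {y} {z} (t , St , walk) yz with G y z in eq
    ... | true  = let y≢v , z≢v = healed-avoids yz in
      t , St , step (∖-intro {K = G} (Adj-sym simple (subst T (sym eq) tt)) z≢v y≢v) walk
    ... | false = let vy , _ = new⇒neighbours (new-intro yz eq)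
                      y≡t    = neighbours-separated simple acyclic vy (S⊆neighbours St) walk in
      z , closed (subst S (sym y≡t) St) (new-intro yz eq) , here

    reaches-walk : ∀ {y z} → Reaches y → Walk H y z → Reaches z
    reaches-walk r here           = r
    reaches-walk r (step yx walk) = reaches-walk (reaches-step r yx) walk

    closed-contains-neighbours : ∀ {u w} → S u → Adj G v w → S w
    closed-contains-neighbours {u} {w} Su vw
      with reaches-walk (u , Su , here) (connected u w (neighbour≢v (S⊆neighbours Su)) (neighbour≢v vw))
    ... | t , St , walk =
      subst S (sym (neighbours-separated simple acyclic vw (S⊆neighbours St) walk)) St

  module _ {c} (vc : Adj G v c) (small : ∀ {u} → Adj G v u → u ≢ c → deg N u ≤ 1) where

    attached-to-hub : ∀ {w} → Adj G v w → w ≢ c → Adj N c w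
    attached-to-hub {w} vw w≢c with T? (N c w)
    ... | yes cw = cw
    ... | no ¬cw = ⊥-elim (c∉S (closed-contains-neighbours S S⊆neighbours closed (inj₁ refl) vc))
      where
      -- Closed because every new partner y ≠ c of w has w as its only new partner.
      S : Pred (Fin n) _
      S t = t ≡ w ⊎ Adj N w t

      S⊆neighbours : ∀ {t} → S t → Adj G v t
      S⊆neighbours (inj₁ refl) = vw
      S⊆neighbours (inj₂ wt)   = proj₂ (new⇒neighbours wt)

      closed : ∀ {y z} → S y → Adj N y z → S z
      closed     (inj₁ refl) wz = inj₂ wz
      closed {y} (inj₂ wy)   yz =
        inj₁ (neighbour-unique N (small (S⊆neighbours (inj₂ wy)) y≢c) yz (new-sym wy))
        where
        y≢c : y ≢ c
        y≢c refl = ¬cw (new-sym wy)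

      c∉S : ¬ S c
      c∉S (inj₁ c≡w) = w≢c (sym c≡w)
      c∉S (inj₂ wc)  = ¬cw (new-sym wc)

    hub-bound : deg G v ≤ deg N c + 1
    hub-bound = deg-≤-except G {K′ = N} c (λ w w≢c vw → attached-to-hub vw w≢c)

  module _ {M : ℕ} (bounded : DegreeBounded M G H v) (large : M + 3 ≤ deg G v) where

    Grows : Fin n → Set
    Grows u = deg G u < deg H u

    stable-around-hub-impossible : ∀ {c} → Adj G v c → (∀ {u} → Adj G v u → u ≢ c → ¬ Grows u) → ⊥
    stable-around-hub-impossible {c} vc stable = 3≰2 (+-cancelˡ-≤ M 3 2 (begin
      M + 3       ≤⟨ large ⟩
      deg G v     ≤⟨ hub-bound vc small ⟩
      deg N c + 1 ≤⟨ +-mono-≤ (new-deg-bound (neighbour≢v vc) (bounded c (neighbour≢v vc))) ≤-refl ⟩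
      M + 1 + 1   ≡⟨ +-assoc M 1 1 ⟩
      M + 2       ∎))
      where
      open ≤-Reasoning
      3≰2 : ¬ 3 ≤ 2
      3≰2 (s≤s (s≤s ()))
      small : ∀ {u} → Adj G v u → u ≢ c → deg N u ≤ 1
      small vu u≢c = new-deg-bound (neighbour≢v vu)
        (subst (deg H _ ≤_) (sym (+-identityʳ _)) (≮⇒≥ (stable vu u≢c)))

    another-neighbour-grows : ∀ c → ∃ λ u → u ≢ c × Adj G v u × Grows u
    another-neighbour-grows c
      with any? (λ u → ¬? (u ≟ c) ×-dec T? (G v u) ×-dec (deg G u <? deg H u))
    ... | yes found = found
    ... | no  none with T? (G v c)
    ...   | yes vc  = ⊥-elim (stable-around-hub-impossible vc
                        (λ vu u≢c grows → none (_ , u≢c , vu , grows)))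
    ...   | no  ¬vc with deg-positive⇒neighbour G (≤-trans (m≤n+m 1 2) (≤-trans (m≤n+m 3 M) large))
    ...     | _ , vc₀ = ⊥-elim (stable-around-hub-impossible vc₀
                          (λ vu _ grows → none (_ , (λ { refl → ¬vc vu }) , vu , grows)))

lemma2p12 : (M : ℕ) → 1 ≤ M → {n : ℕ} → (G H : Graph n) → (v : Fin n) →
    IsTree G → LocalHealing G H v → DegreeBounded M G H v →
    M + 3 ≤ deg G v →
    Σ (Fin n) λ u₁ → Σ (Fin n) λ u₂ → u₁ ≢ u₂ ×
      Adj G v u₁ × Adj G v u₂ × deg G u₁ < deg H u₁ × deg G u₂ < deg H u₂
lemma2p12 M _ G H v (simple , _ , acyclic) healing bounded large =
  let open Healing simple acyclic healing
      u₁ , _      , vu₁ , grows₁ = another-neighbour-grows bounded large v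
      u₂ , u₂≢u₁ , vu₂ , grows₂ = another-neighbour-grows bounded large u₁
  in u₁ , u₂ , u₂≢u₁ ∘ sym , vu₁ , vu₂ , grows₁ , grows₂
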